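{- For each prime $p$, the zero-divisor graphs $\Gamma(R)$ of the rings $R = \mathbb{Z}_{p}[x]/(x^p)$, $R = \mathbb{Z}_{p}[x,y]/(x^3, xy, y^2)$, and $R = \mathbb{Z}_{p^2}[x]/(px, x^2-p)$ are connected threshold graphs.
   Context: For a finite commutative ring $R$ with unity, the zero-divisor graph $\Gamma(R)$ is the simple graph whose vertex set is all of $R$, two distinct vertices $x,y\in R$ being adjacent if and only if $xy=0$ in $R$. A graph is a threshold graph if it can be obtained from the one-vertex graph $K_1$ by repeatedly (any number of times, in any order) adding either an isolated vertex or a dominating vertex (a new vertex adjacent to all existing vertices). -}

module Defs where

open import Data.Nat using (ℕ; zero; suc; _+_; _*_; _∸_; NonZero)
open import Data.Nat.Properties using (m*n≢0)
open import Data.Nat.ListAction using (sum)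
open import Data.Nat.DivMod using (_mod_)
open import Data.Fin using (Fin; toℕ) renaming (zero to fzero; suc to fsuc)
open import Data.Vec using (Vec; []; _∷_; tabulate; replicate)
open import Data.List using (List; []; _∷_; length; map; upTo)
open import Data.Bool using (Bool; true; false)
open import Data.Product using (Σ; _×_; _,_)
open import Data.Empty using (⊥)
open import Relation.Nullary using (¬_)
open import Relation.Binary.PropositionalEquality using (_≡_; _≢_)
open import Function.Bundles using (_⤖_; _⇔_; Bijection)

-- Finite (raw) commutative rings, as far as the zero-divisor graph needs:
-- a carrier with canonical normal forms (so _≡_ is ring equality),
-- a multiplication and a zero.

record RawMulRing : Set₁ where
  field
    Carrier : Set
    _·_     : Carrier → Carrier → Carrier
    𝟘       : Carrier

record Graph : Set₁ where
  field
    V   : Set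
    Adj : V → V → Set

open Graph public

Γ : RawMulRing → Graph
Γ R = record { V = Carrier ; Adj = λ x y → (x ≢ y) × (x · y ≡ 𝟘) }
  where open RawMulRing R

data Walk (G : Graph) : V G → V G → Set where
  here : ∀ {x} → Walk G x x
  step : ∀ {x y z} → Adj G x y → Walk G y z → Walk G x z

Connected : Graph → Set
Connected G = Σ (V G) (λ _ → ∀ x y → Walk G x y)

-- A creation sequence bs = b_k ∷ … ∷ b_1 describes the graph obtained from K₁
-- by adding, in order, vertices with choices b_1, …, b_k
-- (true = dominating vertex, false = isolated vertex).
-- Its vertex set is Fin (suc k); vertex fzero is the most recently added one.

ThrAdj : (bs : List Bool) → Fin (suc (length bs)) → Fin (suc (length bs)) → Bool
ThrAdj []       _        _        = false
ThrAdj (b ∷ bs) fzero    fzero    = false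
ThrAdj (b ∷ bs) fzero    (fsuc j) = b
ThrAdj (b ∷ bs) (fsuc i) fzero    = b
ThrAdj (b ∷ bs) (fsuc i) (fsuc j) = ThrAdj bs i j

ThresholdGraphOf : List Bool → Graph
ThresholdGraphOf bs = record { V = Fin (suc (length bs)) ; Adj = λ i j → ThrAdj bs i j ≡ true }

_≅_ : Graph → Graph → Set
G ≅ H = Σ (V G ⤖ V H) λ f → ∀ x y → Adj G x y ⇔ Adj H (Bijection.to f x) (Bijection.to f y)

IsThreshold : Graph → Set
IsThreshold G = Σ (List Bool) λ bs → ThresholdGraphOf bs ≅ G

module _ (p : ℕ) .{{_ : NonZero p}} where

  -- Z_p[x]/(x^p): a_0 + a_1 x + … + a_{p-1} x^{p-1} ↦ vector of coefficients in Z_p = Fin p.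
  -- coeff a k = a_k as a natural number (0 if k ≥ p)
  coeff : ∀ {n} → Vec (Fin p) n → ℕ → ℕ
  coeff []       _       = 0
  coeff (x ∷ xs) zero    = toℕ x
  coeff (x ∷ xs) (suc k) = coeff xs k

  TruncPoly : RawMulRing
  TruncPoly = record
    { Carrier = Vec (Fin p) p
    ; _·_ = λ a b → tabulate λ k →
        sum (map (λ i → coeff a i * coeff b (toℕ k ∸ i)) (upTo (suc (toℕ k)))) mod p
    ; 𝟘 = replicate p (0 mod p)
    }

  -- Z_p[x,y]/(x^3, xy, y^2): a + b x + c x² + d y  ↦  (a , b , c , d)
  Ring2 : RawMulRing
  Ring2 = record
    { Carrier = Fin p × Fin p × Fin p × Fin p
    ; _·_ = λ { (a , b , c , d) (a' , b' , c' , d') →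
          (toℕ a * toℕ a') mod p
        , (toℕ a * toℕ b' + toℕ b * toℕ a') mod p
        , (toℕ a * toℕ c' + toℕ b * toℕ b' + toℕ c * toℕ a') mod p
        , (toℕ a * toℕ d' + toℕ d * toℕ a') mod p }
    ; 𝟘 = 0 mod p , 0 mod p , 0 mod p , 0 mod p
    }

  -- Z_{p²}[x]/(px, x² - p): a + b x with a ∈ Z_{p²} = Fin (p*p), b ∈ Z_p = Fin p
  -- (px = 0 makes b live mod p; x² = p).
  -- (a + b x)(a' + b' x) = (a a' + p b b') + (a b' + b a') x.
  Ring3 : RawMulRing
  Ring3 = record
    { Carrier = Fin (p * p) × Fin p
    ; _·_ = λ { (a , b) (a' , b') →
          (toℕ a * toℕ a' + p * (toℕ b * toℕ b')) mod (p * p)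
        , (toℕ a * toℕ b' + toℕ b * toℕ a') mod p }
    ; 𝟘 = 0 mod (p * p) , 0 mod p
    }
    where instance _ = m*n≢0 p p

-- Each ring R carries a weight w on its elements and a bound t such that xy = 0 exactly when
-- w x + w y ≥ t: for Z_p[x]/(x^p) the x-adic valuation with t = p, and for the two other (local)
-- rings the weights 0, 1, 2, 3 on units, elements of 𝔪 ∖ Ann 𝔪, nonzero elements of Ann 𝔪, and 0,
-- with t = 3.  A graph given by vertex weights in this way is threshold: either the heaviest vertex
-- is joined to every other vertex or the lightest one to none, and deleting it leaves a graph of
-- the same kind.  Zero has the largest weight, so it is adjacent to every other vertex and Γ(R) is
-- connected.

module Submission where

open import Defs
open import Data.Bool using (Bool; true; false)
open import Data.Empty using (⊥-elim)
open import Data.Fin using (Fin; toℕ; fromℕ<; punchIn) renaming (zero to fzero; suc to fsuc)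
open import Data.Fin.Permutation using (insert; insert-punchIn)
open import Data.Fin.Properties
  using (*↔×; ¬Fin0; toℕ-fromℕ<; toℕ-injective; toℕ<n; punchInᵢ≢i; punchIn-injective; inj⇒≟)
open import Data.List using ([]; _∷_; length; allFin; map; upTo; applyUpTo)
open import Data.List.Extrema.Nat using (argmin; argmax; f[argmin]≤f[xs]; f[xs]≤f[argmax])
open import Data.List.Membership.Propositional.Properties using (∈-allFin)
open import Data.List.Properties using (map-upTo)
import Data.List.Relation.Unary.All as All
open import Data.Nat using (ℕ; NonZero; suc; _+_; _*_; _∸_; _≤_; _<_; _≤?_; _<?_; s≤s; z<s; s<s)
open import Data.Nat.DivMod using (_mod_; _%_; m%n<n)
open import Data.Nat.Divisibility
  using (_∣_; divides; _∣?_; _∣0; ∣-refl; ∣-trans; m∣m*n; n∣m*n; *-pres-∣; *-cancelˡ-∣; *-cancelʳ-∣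
        ; ∣m+n∣m⇒∣n; ∣m∣n⇒∣m+n; m%n≡0⇔n∣m; ∣⇒≤)
open import Data.Nat.ListAction using (sum)
open import Data.Nat.Primality using (Prime; euclidsLemma)
open import Data.Nat.Properties
  using (≤-refl; ≤-reflexive; ≤-trans; <-≤-trans; ≤-<-trans; <-cmp; <⇒≱; ≮⇒≥; n≤1+n; m≤m+n; m≤n+m
        ; +-comm; +-identityʳ; +-monoʳ-≤; +-monoˡ-≤; *-comm; *-assoc; *-zeroʳ; suc-injective
        ; m+n∸m≡n; ∸-monoʳ-≤; ∸-monoˡ-<; ∸-monoʳ-<)
open import Data.Nat.Tactic.RingSolver using (solve-∀)
open import Data.Product using (∃₂; _×_; _,_; proj₁; proj₂)
import Data.Product as Product
open import Data.Sum using (_⊎_; inj₁; inj₂)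
open import Data.Vec using (Vec; []; _∷_; tabulate; replicate; lookup)
open import Data.Vec.Properties using (lookup∘tabulate; lookup-replicate; tabulate-cong; tabulate∘lookup)
open import Data.Vec.Recursive using (Fin[m^n]↔Fin[m]^n)
open import Data.Vec.Recursive.Properties using (↔Vec)
open import Function using (_∘_; case_of_)
open import Function.Bundles using (_⤖_; _↔_; _⇔_; Bijection; Inverse; Equivalence; mk⇔)
open import Function.Construct.Composition using (_⤖-∘_; _⇔-∘_; _↔-∘_)
open import Function.Construct.Identity using (⤖-id)
open import Function.Construct.Symmetry using (⇔-sym; ↔-sym)
open import Function.Definitions using (Injective)
open import Function.Properties.Bijection using (⤖⇒↔)
open import Function.Properties.Inverse using (↔⇒⤖; ↔⇒↣)
open import Relation.Binary.Definitions using (DecidableEquality; tri<; tri≈; tri>)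
open import Relation.Binary.PropositionalEquality
  using (_≡_; _≢_; refl; sym; trans; cong; cong₂; subst; module ≡-Reasoning)
open import Relation.Nullary using (¬_; Dec; yes; no)

-- Threshold graphs from vertex weights

≅-trans : ∀ {G H K} → G ≅ H → H ≅ K → G ≅ K
≅-trans (f , f-adj) (g , g-adj) = g ⤖-∘ f , λ x y → g-adj _ _ ⇔-∘ f-adj x y

isThreshold-resp-≅ : ∀ {G H} → IsThreshold G → G ≅ H → IsThreshold H
isThreshold-resp-≅ {H = H} (bs , T≅G) G≅H = bs , ≅-trans {K = H} T≅G G≅H

WeightGraph : (A : Set) → ℕ → (A → ℕ) → Graph
WeightGraph A t w = record { V = A ; Adj = λ x y → x ≢ y × t ≤ w x + w y }

module _ {A : Set} (t : ℕ) (w : A → ℕ) where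

  weightAdj-sym : ∀ x y → Adj (WeightGraph A t w) x y ⇔ Adj (WeightGraph A t w) y x
  weightAdj-sym x y = mk⇔ swap swap
    where
    swap : ∀ {x y} → Adj (WeightGraph A t w) x y → Adj (WeightGraph A t w) y x
    swap {x} {y} (x≢y , t≤) = x≢y ∘ sym , subst (t ≤_) (+-comm (w x) (w y)) t≤

  weightAdj-pullback : ∀ {B : Set} (f : B → A) → Injective _≡_ _≡_ f →
    ∀ x y → Adj (WeightGraph B t (w ∘ f)) x y ⇔ Adj (WeightGraph A t w) (f x) (f y)
  weightAdj-pullback f f-inj x y =
    mk⇔ (Product.map₁ (λ x≢y → x≢y ∘ f-inj)) (Product.map₁ (λ fx≢fy → fx≢fy ∘ cong f))

  WeightGraph-≅ : ∀ {B : Set} (e : B ⤖ A) → WeightGraph B t (w ∘ Bijection.to e) ≅ WeightGraph A t w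
  WeightGraph-≅ e = e , weightAdj-pullback (Bijection.to e) (Bijection.injective e)

module _ {n : ℕ} (t : ℕ) (w : Fin (suc n) → ℕ) where

  lightest heaviest : Fin (suc n)
  lightest = argmin w fzero (allFin _)
  heaviest = argmax w fzero (allFin _)

  lightest-≤ : ∀ j → w lightest ≤ w j
  lightest-≤ j = All.lookup (f[argmin]≤f[xs] {f = w} fzero (allFin _)) (∈-allFin j)

  ≤-heaviest : ∀ j → w j ≤ w heaviest
  ≤-heaviest j = All.lookup (f[xs]≤f[argmax] {f = w} fzero (allFin _)) (∈-allFin j)

  -- If the heaviest vertex is not joined to the lightest one, the lightest is joined to nobody.
  dominatingOrIsolated : ∃₂ λ k b → ∀ j → t ≤ w k + w j ⇔ b ≡ true
  dominatingOrIsolated with t ≤? w heaviest + w lightest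
  ... | yes t≤ = heaviest , true , λ j →
    mk⇔ (λ _ → refl) (λ _ → ≤-trans t≤ (+-monoʳ-≤ _ (lightest-≤ j)))
  ... | no t≰ = lightest , false , λ j → mk⇔ (λ t≤ → ⊥-elim (t≰ (≤-trans t≤ (lightest+j≤ j)))) (λ ())
    where
    lightest+j≤ : ∀ j → w lightest + w j ≤ w heaviest + w lightest
    lightest+j≤ j = subst (_≤ w heaviest + w lightest) (+-comm (w j) _) (+-monoˡ-≤ (w lightest) (≤-heaviest j))

module _ {n : ℕ} (t : ℕ) (w : Fin (suc (suc n)) → ℕ) (k : Fin (suc (suc n))) (b : Bool)
         (k-adj : ∀ j → t ≤ w k + w j ⇔ b ≡ true) where

  private
    G : Graph
    G = WeightGraph (Fin (suc (suc n))) t w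

  k~punchIn : ∀ j → Adj G k (punchIn k j) ⇔ b ≡ true
  k~punchIn j = mk⇔ (Equivalence.to (k-adj _) ∘ proj₂)
                    (λ b≡true → (λ k≡ → punchInᵢ≢i k j (sym k≡)) , Equivalence.from (k-adj _) b≡true)

  addVertex : ∀ {bs} → ThresholdGraphOf bs ≅ WeightGraph (Fin (suc n)) t (w ∘ punchIn k) →
    ThresholdGraphOf (b ∷ bs) ≅ G
  addVertex {bs} (π , π-adj) = ↔⇒⤖ σ , adj
    where
    σ : Fin (suc (suc (length bs))) ↔ Fin (suc (suc n))
    σ = insert fzero k (⤖⇒↔ π)
    σ-fsuc : ∀ i → Inverse.to σ (fsuc i) ≡ punchIn k (Bijection.to π i)
    σ-fsuc = insert-punchIn fzero k (⤖⇒↔ π)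
    adj : ∀ x y → ThrAdj (b ∷ bs) x y ≡ true ⇔ Adj G (Inverse.to σ x) (Inverse.to σ y)
    adj fzero    fzero    = mk⇔ (λ ()) (λ (k≢k , _) → ⊥-elim (k≢k refl))
    adj fzero    (fsuc j) rewrite σ-fsuc j = ⇔-sym (k~punchIn _)
    adj (fsuc i) fzero    rewrite σ-fsuc i = weightAdj-sym t w _ _ ⇔-∘ ⇔-sym (k~punchIn _)
    adj (fsuc i) (fsuc j) rewrite σ-fsuc i | σ-fsuc j =
      weightAdj-pullback t w (punchIn k) (punchIn-injective k _ _) _ _ ⇔-∘ π-adj i j

weighted⇒threshold : ∀ n t (w : Fin (suc n) → ℕ) → IsThreshold (WeightGraph (Fin (suc n)) t w)
weighted⇒threshold 0       t w =
  [] , ⤖-id _ , λ { fzero fzero → mk⇔ (λ ()) (λ (0≢0 , _) → ⊥-elim (0≢0 refl)) }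
weighted⇒threshold (suc n) t w =
  let (k , b , k-adj) = dominatingOrIsolated t w
      (bs , iso) = weighted⇒threshold n t (w ∘ punchIn k)
  in b ∷ bs , addVertex t w k b k-adj iso

_◅◅_ : ∀ {G x y z} → Walk G x y → Walk G y z → Walk G x z
here      ◅◅ q = q
step xy p ◅◅ q = step xy (p ◅◅ q)

connected-via : ∀ G → DecidableEquality (V G) → (c : V G) →
  (∀ x → x ≢ c → Adj G x c) → (∀ y → c ≢ y → Adj G c y) → Connected G
connected-via G _≟_ c x~c c~y = c , λ x y → walkTo x ◅◅ walkFrom y
  where
  walkTo : ∀ x → Walk G x c
  walkTo x with x ≟ c
  ... | yes refl = here
  ... | no x≢c   = step (x~c x x≢c) here
  walkFrom : ∀ y → Walk G c y
  walkFrom y with c ≟ y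
  ... | yes refl = here
  ... | no c≢y   = step (c~y y c≢y) here

-- Zero-divisor graphs

record ZeroDivisorWeights (R : RawMulRing) : Set where
  open RawMulRing R
  field
    threshold         : ℕ
    weight            : Carrier → ℕ
    threshold≤weight𝟘 : threshold ≤ weight 𝟘
    ·≡𝟘⇔              : ∀ x y → x · y ≡ 𝟘 ⇔ threshold ≤ weight x + weight y

module _ {R : RawMulRing} (W : ZeroDivisorWeights R) where
  open RawMulRing R
  open ZeroDivisorWeights W

  WeightGraph≅Γ : WeightGraph Carrier threshold weight ≅ Γ R
  WeightGraph≅Γ = ⤖-id _ , λ x y →
    mk⇔ (Product.map₂ (Equivalence.from (·≡𝟘⇔ x y))) (Product.map₂ (Equivalence.to (·≡𝟘⇔ x y)))

  Γ-isThreshold : ∀ {m} → Fin m ↔ Carrier → IsThreshold (Γ R)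
  Γ-isThreshold {0}     enum = ⊥-elim (¬Fin0 (Inverse.from enum 𝟘))
  Γ-isThreshold {suc n} enum =
    isThreshold-resp-≅ {H = Γ R} (weighted⇒threshold n threshold (weight ∘ Inverse.to enum))
      (≅-trans {K = Γ R} (WeightGraph-≅ threshold weight (↔⇒⤖ enum)) WeightGraph≅Γ)

  Γ-connected : ∀ {m} → Fin m ↔ Carrier → Connected (Γ R)
  Γ-connected enum = connected-via (Γ R) (inj⇒≟ (↔⇒↣ (↔-sym enum))) 𝟘
    (λ x x≢𝟘 → x≢𝟘 , x·𝟘≡𝟘 x) (λ y 𝟘≢y → 𝟘≢y , 𝟘·x≡𝟘 y)
    where
    𝟘·x≡𝟘 : ∀ x → 𝟘 · x ≡ 𝟘
    𝟘·x≡𝟘 x = Equivalence.from (·≡𝟘⇔ 𝟘 x) (≤-trans threshold≤weight𝟘 (m≤m+n _ _))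
    x·𝟘≡𝟘 : ∀ x → x · 𝟘 ≡ 𝟘
    x·𝟘≡𝟘 x = Equivalence.from (·≡𝟘⇔ x 𝟘) (≤-trans threshold≤weight𝟘 (m≤n+m _ _))

  Γ-connected-threshold : ∀ {m} → Fin m ↔ Carrier → Connected (Γ R) × IsThreshold (Γ R)
  Γ-connected-threshold enum = Γ-connected enum , Γ-isThreshold enum

-- For a finite local ring with maximal ideal 𝔪: the units, 𝔪 ∖ Ann 𝔪, Ann 𝔪 ∖ {0}, and 0.
data Layer : Set where
  unit middle socle zero : Layer

depth : Layer → ℕ
depth unit   = 0
depth middle = 1
depth socle  = 2
depth zero   = 3

record Layering (R : RawMulRing) : Set where
  open RawMulRing R
  field
    layer              : Carrier → Layer
    ·-comm             : ∀ x y → x · y ≡ y · x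
    𝟘·x≡𝟘              : ∀ x → 𝟘 · x ≡ 𝟘
    layer-𝟘            : layer 𝟘 ≡ zero
    layer≡zero⇒≡𝟘      : ∀ {x} → layer x ≡ zero → x ≡ 𝟘
    unit-cancel        : ∀ {x y} → layer x ≡ unit → x · y ≡ 𝟘 → y ≡ 𝟘
    middle·middle≢𝟘    : ∀ {x y} → layer x ≡ middle → layer y ≡ middle → x · y ≢ 𝟘
    socle·nonunit≡𝟘    : ∀ {x y} → layer x ≡ socle → layer y ≢ unit → x · y ≡ 𝟘

  private
    ≡𝟘⇒layer≡zero : ∀ {y l} → layer y ≡ l → y ≡ 𝟘 → l ≡ zero
    ≡𝟘⇒layer≡zero refl refl = layer-𝟘

  ·≡𝟘⇒deep : ∀ x y → x · y ≡ 𝟘 → 3 ≤ depth (layer x) + depth (layer y)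
  ·≡𝟘⇒deep x y xy≡𝟘 with layer x in lx | layer y in ly
  ... | zero   | l      = m≤m+n 3 (depth l)
  ... | l      | zero   = m≤n+m 3 (depth l)
  ... | middle | socle  = ≤-refl
  ... | socle  | middle = ≤-refl
  ... | socle  | socle  = n≤1+n 3
  ... | middle | middle = ⊥-elim (middle·middle≢𝟘 lx ly xy≡𝟘)
  ... | unit   | unit   with () ← ≡𝟘⇒layer≡zero ly (unit-cancel lx xy≡𝟘)
  ... | unit   | middle with () ← ≡𝟘⇒layer≡zero ly (unit-cancel lx xy≡𝟘)
  ... | unit   | socle  with () ← ≡𝟘⇒layer≡zero ly (unit-cancel lx xy≡𝟘)
  ... | middle | unit   with () ← ≡𝟘⇒layer≡zero lx (unit-cancel ly (trans (·-comm y x) xy≡𝟘))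
  ... | socle  | unit   with () ← ≡𝟘⇒layer≡zero lx (unit-cancel ly (trans (·-comm y x) xy≡𝟘))

  deep⇒·≡𝟘 : ∀ x y → 3 ≤ depth (layer x) + depth (layer y) → x · y ≡ 𝟘
  deep⇒·≡𝟘 x y deep with layer x in lx | layer y in ly
  ... | zero   | _      rewrite layer≡zero⇒≡𝟘 lx = 𝟘·x≡𝟘 y
  ... | _      | zero   rewrite layer≡zero⇒≡𝟘 ly = trans (·-comm x 𝟘) (𝟘·x≡𝟘 x)
  ... | socle  | middle = socle·nonunit≡𝟘 lx λ ly′ → case trans (sym ly) ly′ of λ ()
  ... | socle  | socle  = socle·nonunit≡𝟘 lx λ ly′ → case trans (sym ly) ly′ of λ ()
  ... | middle | socle  = trans (·-comm x y) (socle·nonunit≡𝟘 ly λ lx′ → case trans (sym lx) lx′ of λ ())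
  deep⇒·≡𝟘 x y () | unit   | unit
  deep⇒·≡𝟘 x y (s≤s ()) | unit   | middle
  deep⇒·≡𝟘 x y (s≤s (s≤s ())) | unit   | socle
  deep⇒·≡𝟘 x y (s≤s ()) | middle | unit
  deep⇒·≡𝟘 x y (s≤s (s≤s ())) | middle | middle
  deep⇒·≡𝟘 x y (s≤s (s≤s ())) | socle  | unit

  zeroDivisorWeights : ZeroDivisorWeights R
  zeroDivisorWeights = record
    { threshold = 3 ; weight = depth ∘ layer
    ; threshold≤weight𝟘 = subst (λ l → 3 ≤ depth l) (sym layer-𝟘) ≤-refl
    ; ·≡𝟘⇔ = λ x y → mk⇔ (·≡𝟘⇒deep x y) (deep⇒·≡𝟘 x y) }

cross-comm : ∀ a b a′ b′ → a * b′ + b * a′ ≡ a′ * b + b′ * a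
cross-comm = solve-∀

m+n*0≡m : ∀ m n → m + n * 0 ≡ m
m+n*0≡m m n = trans (cong (m +_) (*-zeroʳ n)) (+-identityʳ m)

sum-applyUpTo-≡0 : ∀ n (f : ℕ → ℕ) → (∀ i → i < n → f i ≡ 0) → sum (applyUpTo f n) ≡ 0
sum-applyUpTo-≡0 0       f f≡0 = refl
sum-applyUpTo-≡0 (suc n) f f≡0 rewrite f≡0 0 z<s =
  sum-applyUpTo-≡0 n (f ∘ suc) (λ i i<n → f≡0 (suc i) (s<s i<n))

sum-applyUpTo-single : ∀ n (f : ℕ → ℕ) {j} → j < n → (∀ i → i < n → i ≢ j → f i ≡ 0) →
  sum (applyUpTo f n) ≡ f j
sum-applyUpTo-single (suc n) f {0} _ f≡0
  rewrite sum-applyUpTo-≡0 n (f ∘ suc) (λ i i<n → f≡0 (suc i) (s<s i<n) λ ()) = +-identityʳ (f 0)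
sum-applyUpTo-single (suc n) f {suc j} (s<s j<n) f≡0
  rewrite f≡0 0 z<s (λ ()) =
  sum-applyUpTo-single n (f ∘ suc) j<n (λ i i<n i≢j → f≡0 (suc i) (s<s i<n) (i≢j ∘ suc-injective))

tabulate≡replicate⇔ : ∀ {A : Set} {n} (f : Fin n → A) x → tabulate f ≡ replicate n x ⇔ (∀ k → f k ≡ x)
tabulate≡replicate⇔ f x = mk⇔
  (λ f≡x k → trans (sym (lookup∘tabulate f k)) (trans (cong (λ v → lookup v k) f≡x) (lookup-replicate k x)))
  (λ f≗x → trans (tabulate-cong (λ k → trans (f≗x k) (sym (lookup-replicate k x)))) (tabulate∘lookup _))

split-below : ∀ {i k m n} → i ≤ k → k < m + n → i < m ⊎ k ∸ i < n
split-below {i} {k} {m} {n} i≤k k<m+n with i <? m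
... | yes i<m = inj₁ i<m
... | no i≮m  = inj₂ (≤-<-trans (∸-monoʳ-≤ k m≤i)
                     (subst (k ∸ m <_) (m+n∸m≡n m n) (∸-monoˡ-< k<m+n (≤-trans m≤i i≤k))))
  where
  m≤i : m ≤ i
  m≤i = ≮⇒≥ i≮m

split-at : ∀ {i m n} → i ≤ m + n → i ≢ m → i < m ⊎ (m + n) ∸ i < n
split-at {i} {m} {n} i≤m+n i≢m with <-cmp i m
... | tri< i<m _ _ = inj₁ i<m
... | tri≈ _ i≡m _ = ⊥-elim (i≢m i≡m)
... | tri> _ _ m<i = inj₂ (subst ((m + n) ∸ i <_) (m+n∸m≡n m n) (∸-monoʳ-< m<i i≤m+n))

module _ {n : ℕ} where

  mod≡0⇔∣ : ∀ m → m mod suc n ≡ fzero ⇔ suc n ∣ m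
  mod≡0⇔∣ m = m%n≡0⇔n∣m m (suc n) ⇔-∘
    mk⇔ (λ m-mod≡0 → trans (sym toℕ-mod) (cong toℕ m-mod≡0))
        (λ m%n≡0 → toℕ-injective (trans toℕ-mod m%n≡0))
    where
    toℕ-mod : toℕ (m mod suc n) ≡ m % suc n
    toℕ-mod = toℕ-fromℕ< (m%n<n m (suc n))

  ∣toℕ⇒≡0 : (i : Fin (suc n)) → suc n ∣ toℕ i → i ≡ fzero
  ∣toℕ⇒≡0 fzero    _ = refl
  ∣toℕ⇒≡0 (fsuc i) d = ⊥-elim (<⇒≱ (toℕ<n (fsuc i)) (∣⇒≤ d))

module _ {q : ℕ} (p-prime : Prime (suc q)) where
  private
    p = suc q

  p∣a*b⇒p∣b : ∀ {a b} → ¬ p ∣ a → p ∣ a * b → p ∣ b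
  p∣a*b⇒p∣b {a} {b} p∤a p∣ab with euclidsLemma a b p-prime p∣ab
  ... | inj₁ p∣a = ⊥-elim (p∤a p∣a)
  ... | inj₂ p∣b = p∣b

  p*p∣a*b⇒p*p∣b : ∀ {a b} → ¬ p ∣ a → p * p ∣ a * b → p * p ∣ b
  p*p∣a*b⇒p*p∣b {a} {b} p∤a p²∣ab with p∣a*b⇒p∣b p∤a (∣-trans (m∣m*n p) p²∣ab)
  ... | divides k refl = *-pres-∣ p∣k (∣-refl {p})
    where
    p∣k : p ∣ k
    p∣k = p∣a*b⇒p∣b p∤a (*-cancelʳ-∣ p (subst (p * p ∣_) (sym (*-assoc a k p)) p²∣ab))

  nonzero*nonzero-∤ : ∀ {a b : Fin p} → a ≢ fzero → b ≢ fzero → ¬ p ∣ toℕ a * toℕ b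
  nonzero*nonzero-∤ {a} a≢0 b≢0 = b≢0 ∘ ∣toℕ⇒≡0 _ ∘ p∣a*b⇒p∣b (a≢0 ∘ ∣toℕ⇒≡0 a)

  fsuc*fsuc-mod≢0 : ∀ (a b : Fin q) {m} → m ≡ toℕ (fsuc a) * toℕ (fsuc b) → m mod p ≢ fzero
  fsuc*fsuc-mod≢0 a b refl = nonzero*nonzero-∤ {fsuc a} {fsuc b} (λ ()) (λ ()) ∘ Equivalence.to (mod≡0⇔∣ _)

-- Z_p[x]/(x^p)

module _ {n : ℕ} where
  private
    p = suc n

  valuation : ∀ {k} → Vec (Fin p) k → ℕ
  valuation []           = 0
  valuation (fzero ∷ a)  = suc (valuation a)
  valuation (fsuc _ ∷ _) = 0

  valuation-replicate : ∀ k → valuation (replicate k fzero) ≡ k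
  valuation-replicate 0       = refl
  valuation-replicate (suc k) = cong suc (valuation-replicate k)

  coeff-<valuation : ∀ {k} (a : Vec (Fin p) k) {i} → i < valuation a → coeff p a i ≡ 0
  coeff-<valuation (fzero ∷ a) {0}     _         = refl
  coeff-<valuation (fzero ∷ a) {suc i} (s<s i<v) = coeff-<valuation a i<v

  coeff-valuation-∤ : ∀ {k} (a : Vec (Fin p) k) → valuation a < k → ¬ p ∣ coeff p a (valuation a)
  coeff-valuation-∤ (fzero ∷ a)  (s<s v<k) = coeff-valuation-∤ a v<k
  coeff-valuation-∤ (fsuc c ∷ _) _         = λ p∣c → case ∣toℕ⇒≡0 (fsuc c) p∣c of λ ()

  convolution : ∀ {k l} → Vec (Fin p) k → Vec (Fin p) l → ℕ → ℕ
  convolution a b m = sum (map (λ i → coeff p a i * coeff p b (m ∸ i)) (upTo (suc m)))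

  private
    term-vanishes : ∀ {k l} (a : Vec (Fin p) k) (b : Vec (Fin p) l) m i →
      i < valuation a ⊎ m ∸ i < valuation b → coeff p a i * coeff p b (m ∸ i) ≡ 0
    term-vanishes a b m i (inj₁ i<va) rewrite coeff-<valuation a i<va = refl
    term-vanishes a b m i (inj₂ m-i<vb) rewrite coeff-<valuation b m-i<vb = *-zeroʳ (coeff p a i)

  convolution-below : ∀ {k l} (a : Vec (Fin p) k) (b : Vec (Fin p) l) {m} →
    m < valuation a + valuation b → convolution a b m ≡ 0
  convolution-below a b {m} m<va+vb = trans (cong sum (map-upTo _ (suc m)))
    (sum-applyUpTo-≡0 (suc m) _ λ { i (s≤s i≤m) → term-vanishes a b m i (split-below i≤m m<va+vb) })

  convolution-at-valuation : ∀ {k l} (a : Vec (Fin p) k) (b : Vec (Fin p) l) →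
    convolution a b (valuation a + valuation b) ≡ coeff p a (valuation a) * coeff p b (valuation b)
  convolution-at-valuation a b = begin
    convolution a b (va + vb)
      ≡⟨ cong sum (map-upTo _ (suc (va + vb))) ⟩
    sum (applyUpTo (λ i → coeff p a i * coeff p b (va + vb ∸ i)) (suc (va + vb)))
      ≡⟨ sum-applyUpTo-single (suc (va + vb)) _ (s≤s (m≤m+n va vb))
           (λ { i (s≤s i≤va+vb) i≢va → term-vanishes a b (va + vb) i (split-at i≤va+vb i≢va) }) ⟩
    coeff p a va * coeff p b (va + vb ∸ va)
      ≡⟨ cong (λ j → coeff p a va * coeff p b j) (m+n∸m≡n va vb) ⟩
    coeff p a va * coeff p b vb ∎
    where
    open ≡-Reasoning
    va vb : ℕ
    va = valuation a
    vb = valuation b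

module _ {q : ℕ} (p-prime : Prime (suc q)) where
  private
    p = suc q
  open RawMulRing (TruncPoly p)

  ·≡𝟘⇔p∣convolutions : ∀ a b → a · b ≡ 𝟘 ⇔ (∀ (k : Fin p) → p ∣ convolution a b (toℕ k))
  ·≡𝟘⇔p∣convolutions a b =
    mk⇔ (λ ab≡0 → Equivalence.to (mod≡0⇔∣ _) ∘ ab≡0) (λ p∣ab → Equivalence.from (mod≡0⇔∣ _) ∘ p∣ab)
      ⇔-∘ tabulate≡replicate⇔ _ fzero

  p∣convolutions⇔valuations : ∀ (a b : Vec (Fin p) p) →
    (∀ (k : Fin p) → p ∣ convolution a b (toℕ k)) ⇔ p ≤ valuation a + valuation b
  p∣convolutions⇔valuations a b = mk⇔ (λ p∣ab → ≮⇒≥ (shallow⇒∤ p∣ab)) deep⇒∣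
    where
    va vb : ℕ
    va = valuation a
    vb = valuation b
    deep⇒∣ : p ≤ va + vb → ∀ (k : Fin p) → p ∣ convolution a b (toℕ k)
    deep⇒∣ p≤va+vb k = subst (p ∣_) (sym (convolution-below a b (<-≤-trans (toℕ<n k) p≤va+vb))) (p ∣0)
    shallow⇒∤ : (∀ (k : Fin p) → p ∣ convolution a b (toℕ k)) → ¬ va + vb < p
    shallow⇒∤ p∣ab va+vb<p = coeff-valuation-∤ b (≤-<-trans (m≤n+m vb va) va+vb<p)
      (p∣a*b⇒p∣b p-prime (coeff-valuation-∤ a (≤-<-trans (m≤m+n va vb) va+vb<p))
        (subst (p ∣_) (convolution-at-valuation a b)
          (subst (λ m → p ∣ convolution a b m) (toℕ-fromℕ< va+vb<p) (p∣ab (fromℕ< va+vb<p)))))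

  truncPolyWeights : ZeroDivisorWeights (TruncPoly p)
  truncPolyWeights = record
    { threshold = p ; weight = valuation ; threshold≤weight𝟘 = ≤-reflexive (sym (valuation-replicate p))
    ; ·≡𝟘⇔ = λ a b → p∣convolutions⇔valuations a b ⇔-∘ ·≡𝟘⇔p∣convolutions a b }

-- Z_p[x,y]/(x³, xy, y²)

module _ {q : ℕ} (p-prime : Prime (suc q)) where
  private
    p = suc q
  open RawMulRing (Ring2 p)

  layer₂ : Carrier → Layer
  layer₂ (fsuc _ , _      , _      , _     ) = unit
  layer₂ (fzero  , fsuc _ , _      , _     ) = middle
  layer₂ (fzero  , fzero  , fsuc _ , _     ) = socle
  layer₂ (fzero  , fzero  , fzero  , fsuc _) = socle
  layer₂ (fzero  , fzero  , fzero  , fzero ) = zero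

  ·-comm₂ : ∀ x y → x · y ≡ y · x
  ·-comm₂ (a , b , c , d) (a′ , b′ , c′ , d′) =
    cong₂ _,_ (cong (_mod p) (*-comm (toℕ a) (toℕ a′)))
   (cong₂ _,_ (cong (_mod p) (cross-comm (toℕ a) (toℕ b) (toℕ a′) (toℕ b′)))
   (cong₂ _,_ (cong (_mod p) (cross₃ (toℕ a) (toℕ b) (toℕ c) (toℕ a′) (toℕ b′) (toℕ c′)))
              (cong (_mod p) (cross-comm (toℕ a) (toℕ d) (toℕ a′) (toℕ d′)))))
    where
    cross₃ : ∀ a b c a′ b′ c′ → a * c′ + b * b′ + c * a′ ≡ a′ * c + b′ * b + c′ * a
    cross₃ = solve-∀

  layer≡zero⇒≡𝟘₂ : ∀ {x} → layer₂ x ≡ zero → x ≡ 𝟘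
  layer≡zero⇒≡𝟘₂ {fzero , fzero , fzero , fzero} refl = refl
  layer≡zero⇒≡𝟘₂ {fsuc _ , _      , _      , _     } ()
  layer≡zero⇒≡𝟘₂ {fzero  , fsuc _ , _      , _     } ()
  layer≡zero⇒≡𝟘₂ {fzero  , fzero  , fsuc _ , _     } ()
  layer≡zero⇒≡𝟘₂ {fzero  , fzero  , fzero  , fsuc _} ()

  -- The first nonzero coordinate of y, multiplied by the unit coordinate of x, survives in x · y.
  unit-cancel₂ : ∀ {x y} → layer₂ x ≡ unit → x · y ≡ 𝟘 → y ≡ 𝟘
  unit-cancel₂ {fsuc u , b , c , d} {fsuc t , _ , _ , _} refl xy≡𝟘 =
    ⊥-elim (fsuc*fsuc-mod≢0 p-prime u t refl (cong proj₁ xy≡𝟘))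
  unit-cancel₂ {fsuc u , b , c , d} {fzero , fsuc t , _ , _} refl xy≡𝟘 =
    ⊥-elim (fsuc*fsuc-mod≢0 p-prime u t (m+n*0≡m _ (toℕ b)) (cong (proj₁ ∘ proj₂) xy≡𝟘))
  unit-cancel₂ {fsuc u , b , c , d} {fzero , fzero , fsuc t , _} refl xy≡𝟘 =
    ⊥-elim (fsuc*fsuc-mod≢0 p-prime u t (trans (m+n*0≡m _ (toℕ c)) (m+n*0≡m _ (toℕ b)))
                                        (cong (proj₁ ∘ proj₂ ∘ proj₂) xy≡𝟘))
  unit-cancel₂ {fsuc u , b , c , d} {fzero , fzero , fzero , fsuc t} refl xy≡𝟘 =
    ⊥-elim (fsuc*fsuc-mod≢0 p-prime u t (m+n*0≡m _ (toℕ d)) (cong (proj₂ ∘ proj₂ ∘ proj₂) xy≡𝟘))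
  unit-cancel₂ {fsuc _ , _ , _ , _} {fzero , fzero , fzero , fzero} refl _ = refl
  unit-cancel₂ {fzero , fsuc _ , _      , _     } ()
  unit-cancel₂ {fzero , fzero  , fsuc _ , _     } ()
  unit-cancel₂ {fzero , fzero  , fzero  , fsuc _} ()
  unit-cancel₂ {fzero , fzero  , fzero  , fzero } ()

  middle·middle≢𝟘₂ : ∀ {x y} → layer₂ x ≡ middle → layer₂ y ≡ middle → x · y ≢ 𝟘
  middle·middle≢𝟘₂ {fzero , fsuc s , c , _} {fzero , fsuc t , _ , _} refl refl xy≡𝟘 =
    fsuc*fsuc-mod≢0 p-prime s t (m+n*0≡m _ (toℕ c)) (cong (proj₁ ∘ proj₂ ∘ proj₂) xy≡𝟘)
  middle·middle≢𝟘₂ {fsuc _ , _ , _ , _} ()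
  middle·middle≢𝟘₂ {fzero , fzero  , fsuc _ , _     } ()
  middle·middle≢𝟘₂ {fzero , fzero  , fzero  , fsuc _} ()
  middle·middle≢𝟘₂ {fzero , fzero  , fzero  , fzero } ()
  middle·middle≢𝟘₂ {fzero , fsuc _ , _ , _} {fsuc _ , _ , _ , _} _ ()
  middle·middle≢𝟘₂ {fzero , fsuc _ , _ , _} {fzero , fzero  , fsuc _ , _     } _ ()
  middle·middle≢𝟘₂ {fzero , fsuc _ , _ , _} {fzero , fzero  , fzero  , fsuc _} _ ()
  middle·middle≢𝟘₂ {fzero , fsuc _ , _ , _} {fzero , fzero  , fzero  , fzero } _ ()

  socle·nonunit≡𝟘₂ : ∀ {x y} → layer₂ x ≡ socle → layer₂ y ≢ unit → x · y ≡ 𝟘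
  socle·nonunit≡𝟘₂ {fsuc _ , _      , _ , _} ()
  socle·nonunit≡𝟘₂ {fzero  , fsuc _ , _ , _} ()
  socle·nonunit≡𝟘₂ {fzero  , fzero  , c , d} {fsuc _ , _ , _ , _} _ y≢unit = ⊥-elim (y≢unit refl)
  socle·nonunit≡𝟘₂ {fzero  , fzero  , c , d} {fzero  , _ , _ , _} _ _
    rewrite *-zeroʳ (toℕ c) | *-zeroʳ (toℕ d) = refl

  layering₂ : Layering (Ring2 p)
  layering₂ = record
    { layer = layer₂ ; ·-comm = ·-comm₂ ; 𝟘·x≡𝟘 = λ _ → refl ; layer-𝟘 = refl
    ; layer≡zero⇒≡𝟘 = layer≡zero⇒≡𝟘₂ ; unit-cancel = unit-cancel₂
    ; middle·middle≢𝟘 = middle·middle≢𝟘₂ ; socle·nonunit≡𝟘 = socle·nonunit≡𝟘₂ }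

-- Z_{p²}[x]/(px, x² − p)

module _ {q : ℕ} (p-prime : Prime (suc q)) where
  private
    p = suc q
  open RawMulRing (Ring3 p)

  classify₃ : (a : Fin (p * p)) → Dec (p ∣ toℕ a) → Fin p → Layer
  classify₃ _        (no _)  _        = unit
  classify₃ _        (yes _) (fsuc _) = middle
  classify₃ (fsuc _) (yes _) fzero    = socle
  classify₃ fzero    (yes _) fzero    = zero

  layer₃ : Carrier → Layer
  layer₃ (a , b) = classify₃ a (p ∣? toℕ a) b

  classify₃≡unit⇒∤ : ∀ a d b → classify₃ a d b ≡ unit → ¬ p ∣ toℕ a
  classify₃≡unit⇒∤ _        (no p∤a) _        _ = p∤a
  classify₃≡unit⇒∤ _        (yes _)  (fsuc _) ()
  classify₃≡unit⇒∤ (fsuc _) (yes _)  fzero    ()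
  classify₃≡unit⇒∤ fzero    (yes _)  fzero    ()

  classify₃≢unit⇒∣ : ∀ a d b → classify₃ a d b ≢ unit → p ∣ toℕ a
  classify₃≢unit⇒∣ _ (no _)    _ ≢unit = ⊥-elim (≢unit refl)
  classify₃≢unit⇒∣ _ (yes p∣a) _ _     = p∣a

  classify₃≡middle⇒ : ∀ a d b → classify₃ a d b ≡ middle → p ∣ toℕ a × b ≢ fzero
  classify₃≡middle⇒ _        (yes p∣a) (fsuc _) _ = p∣a , λ ()
  classify₃≡middle⇒ (fsuc _) (yes _)   fzero    ()
  classify₃≡middle⇒ fzero    (yes _)   fzero    ()

  classify₃≡socle⇒ : ∀ a d b → classify₃ a d b ≡ socle → p ∣ toℕ a × b ≡ fzero
  classify₃≡socle⇒ (fsuc _) (yes p∣a) fzero    _ = p∣a , refl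
  classify₃≡socle⇒ _        (yes _)   (fsuc _) ()
  classify₃≡socle⇒ fzero    (yes _)   fzero    ()

  classify₃≡zero⇒ : ∀ a d b → classify₃ a d b ≡ zero → (a , b) ≡ 𝟘
  classify₃≡zero⇒ fzero    (yes _) fzero    _ = refl
  classify₃≡zero⇒ _        (yes _) (fsuc _) ()
  classify₃≡zero⇒ (fsuc _) (yes _) fzero    ()

  ·-comm₃ : ∀ x y → x · y ≡ y · x
  ·-comm₃ (a , b) (a′ , b′) =
    cong₂ _,_ (cong (_mod (p * p)) (cong₂ _+_ (*-comm (toℕ a) (toℕ a′))
                                              (cong (p *_) (*-comm (toℕ b) (toℕ b′)))))
              (cong (_mod p) (cross-comm (toℕ a) (toℕ b) (toℕ a′) (toℕ b′)))

  𝟘·x≡𝟘₃ : ∀ x → 𝟘 · x ≡ 𝟘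
  𝟘·x≡𝟘₃ _ rewrite *-zeroʳ p = refl

  unit-cancel₃ : ∀ {x y} → layer₃ x ≡ unit → x · y ≡ 𝟘 → y ≡ 𝟘
  unit-cancel₃ {a , b} {a′ , b′} lx xy≡𝟘 = cong₂ _,_ (∣toℕ⇒≡0 a′ p²∣a′) b′≡0
    where
    p∤a : ¬ p ∣ toℕ a
    p∤a = classify₃≡unit⇒∤ a _ b lx
    p²∣first : p * p ∣ toℕ a * toℕ a′ + p * (toℕ b * toℕ b′)
    p²∣first = Equivalence.to (mod≡0⇔∣ _) (cong proj₁ xy≡𝟘)
    p∣second : p ∣ toℕ a * toℕ b′ + toℕ b * toℕ a′
    p∣second = Equivalence.to (mod≡0⇔∣ _) (cong proj₂ xy≡𝟘)
    p∣a′ : p ∣ toℕ a′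
    p∣a′ = p∣a*b⇒p∣b p-prime p∤a
      (∣m+n∣m⇒∣n (subst (p ∣_) (+-comm (toℕ a * toℕ a′) _) (∣-trans (m∣m*n p) p²∣first)) (m∣m*n _))
    b′≡0 : b′ ≡ fzero
    b′≡0 = ∣toℕ⇒≡0 b′ (p∣a*b⇒p∣b p-prime p∤a (∣m+n∣m⇒∣n (subst (p ∣_) (+-comm (toℕ a * toℕ b′) _) p∣second)
                                                 (∣-trans p∣a′ (n∣m*n (toℕ b)))))
    first≡aa′ : toℕ a * toℕ a′ + p * (toℕ b * toℕ b′) ≡ toℕ a * toℕ a′
    first≡aa′ rewrite b′≡0 | *-zeroʳ (toℕ b) = m+n*0≡m _ p
    p²∣a′ : p * p ∣ toℕ a′
    p²∣a′ = p*p∣a*b⇒p*p∣b p-prime p∤a (subst (p * p ∣_) first≡aa′ p²∣first)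

  middle·middle≢𝟘₃ : ∀ {x y} → layer₃ x ≡ middle → layer₃ y ≡ middle → x · y ≢ 𝟘
  middle·middle≢𝟘₃ {a , b} {a′ , b′} lx ly xy≡𝟘
    with classify₃≡middle⇒ a _ b lx | classify₃≡middle⇒ a′ _ b′ ly
  ... | p∣a , b≢0 | p∣a′ , b′≢0 = nonzero*nonzero-∤ p-prime b≢0 b′≢0 (*-cancelˡ-∣ p p²∣pbb′)
    where
    p²∣pbb′ : p * p ∣ p * (toℕ b * toℕ b′)
    p²∣pbb′ = ∣m+n∣m⇒∣n (Equivalence.to (mod≡0⇔∣ _) (cong proj₁ xy≡𝟘)) (*-pres-∣ p∣a p∣a′)

  socle·nonunit≡𝟘₃ : ∀ {x y} → layer₃ x ≡ socle → layer₃ y ≢ unit → x · y ≡ 𝟘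
  socle·nonunit≡𝟘₃ {a , b} {a′ , b′} lx ly with classify₃≡socle⇒ a _ b lx
  ... | p∣a , refl =
    cong₂ _,_ (Equivalence.from (mod≡0⇔∣ _) p²∣first) (Equivalence.from (mod≡0⇔∣ _) p∣second)
    where
    p∣a′ : p ∣ toℕ a′
    p∣a′ = classify₃≢unit⇒∣ a′ _ b′ ly
    p²∣first : p * p ∣ toℕ a * toℕ a′ + p * 0
    p²∣first = subst (p * p ∣_) (sym (m+n*0≡m _ p)) (*-pres-∣ p∣a p∣a′)
    p∣second : p ∣ toℕ a * toℕ b′ + 0
    p∣second = ∣m∣n⇒∣m+n (∣-trans p∣a (m∣m*n _)) (p ∣0)

  layering₃ : Layering (Ring3 p)
  layering₃ = record
    { layer = layer₃ ; ·-comm = ·-comm₃ ; 𝟘·x≡𝟘 = 𝟘·x≡𝟘₃ ; layer-𝟘 = refl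
    ; layer≡zero⇒≡𝟘 = λ {x} → classify₃≡zero⇒ (proj₁ x) _ (proj₂ x) ; unit-cancel = unit-cancel₃
    ; middle·middle≢𝟘 = middle·middle≢𝟘₃ ; socle·nonunit≡𝟘 = socle·nonunit≡𝟘₃ }

mainTheorem5 : (p : ℕ) .{{_ : NonZero p}} → Prime p →
    (Connected (Γ (TruncPoly p)) × IsThreshold (Γ (TruncPoly p)))
    × (Connected (Γ (Ring2 p)) × IsThreshold (Γ (Ring2 p)))
    × (Connected (Γ (Ring3 p)) × IsThreshold (Γ (Ring3 p)))
mainTheorem5 p@(suc _) p-prime =
    Γ-connected-threshold (truncPolyWeights p-prime) (↔Vec p ↔-∘ Fin[m^n]↔Fin[m]^n p p)
  , Γ-connected-threshold (Layering.zeroDivisorWeights (layering₂ p-prime)) (Fin[m^n]↔Fin[m]^n p 4)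
  , Γ-connected-threshold (Layering.zeroDivisorWeights (layering₃ p-prime)) (*↔× {p * p} {p})
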